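{- Let $\phi_{\mathrm{xor}}$ be a satisfiable conjunction of xor-constraints and let $\langle \mathcal{E},\tau\rangle$ be a consistent, propagation saturated assigned tableau for $\phi_{\mathrm{xor}}$. For any two distinct variables $y,z$ of $\phi_{\mathrm{xor}}$ and any $p\in\mathbb{B}$, it holds that $\phi_{\mathrm{xor}} \land \bigwedge_{(x \mapsto v_x) \in \tau}(x \equiv v_x) \models (y \oplus z \equiv p)$ if and only if one of the following holds: (1) $\tau(y)$ and $\tau(z)$ are both defined and $\tau(y)\oplus\tau(z)=p$; (2) $\tau(y)$ and $\tau(z)$ are undefined and $\mathcal{E}$ has an equation $e$ with left-hand side $y$ and with $z$ occurring in its right-hand side such that $e|_\tau$ is $y := z \oplus p$; (3) $\tau(y)$ and $\tau(z)$ are undefined and $\mathcal{E}$ has an equation $e$ with left-hand side $z$ and with $y$ occurring in its right-hand side such that $e|_\tau$ is $z := y \oplus p$; (4) $\tau(y)$ and $\tau(z)$ are undefined and $\mathcal{E}$ has two equations $e_y$ and $e_z$ with left-hand sides $y$ and $z$ respectively such that $e_y|_\tau$ is $y := f$, $e_z|_\tau$ is $z := g$, and $f\oplus g$ (after cancelling duplicate variables and combining constants) equals the constant $p$.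
   Context: Truth values are $\mathbb{B}=\{\bot,\top\}$. An xor-constraint is an equation $x_1 \oplus \dots \oplus x_k \equiv p$ with Boolean variables $x_i$ and parity $p\in\mathbb{B}$ (duplicate variables cancel in pairs). A truth assignment $\tau$ (a possibly partial function from variables to $\mathbb{B}$) satisfies it if $\tau(x_1)\oplus\dots\oplus\tau(x_k)=p$. A tableau for a satisfiable conjunction $\phi_{\mathrm{xor}}$ of xor-constraints is a set $\mathcal{E}$ of equations of the form $x_i := x_{i,1}\oplus\dots\oplus x_{i,k_i}\oplus p_i$, where $x_i,x_{i,1},\dots,x_{i,k_i}$ are distinct variables of $\phi_{\mathrm{xor}}$ and $p_i\in\mathbb{B}$, such that: (1) each variable occurs at most once as a left-hand side variable; (2) a variable occurring as a left-hand side variable does not occur in any right-hand side; (3) the conjunction of the xor-constraints $x_i\oplus x_{i,1}\oplus\dots\oplus x_{i,k_i}\equiv p_i$ over all equations of $\mathcal{E}$ is logically equivalent to $\phi_{\mathrm{xor}}$. An assigned tableau for $\phi_{\mathrm{xor}}$ is a pair $\langle\mathcal{E},\tau\rangle$ where $\mathcal{E}$ is a tableau for $\phi_{\mathrm{xor}}$ and $\tau$ is a possibly partial truth assignment on the variables of $\phi_{\mathrm{xor}}$. It is propagation saturated if for every equation $x_i := x_{i,1}\oplus\dots\oplus x_{i,k_i}\oplus p_i$, $\tau(x_i)$ is defined iff $\tau$ is defined on all of $x_{i,1},\dots,x_{i,k_i}$. It is consistent if there is no equation with $\tau$ defined on all of $x_i,x_{i,1},\dots,x_{i,k_i}$ and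 $\tau(x_i)\neq \tau(x_{i,1})\oplus\dots\oplus\tau(x_{i,k_i})\oplus p_i$. For an equation $e$, $e|_\tau$ denotes the equation obtained from $e$ by substituting every variable assigned by $\tau$ with its value and simplifying (combining constants into a single parity). -}

module Defs where

open import Data.Bool using (Bool; true; false; _xor_)
open import Data.Nat using (ℕ; _≡ᵇ_)
open import Data.List using (List; []; _∷_; _++_; foldr; concatMap)
open import Data.List.Membership.Propositional using (_∈_; _∉_)
open import Data.List.Relation.Unary.All using (All)
open import Data.List.Relation.Unary.Unique.Propositional using (Unique)
open import Data.Maybe using (Maybe; just; nothing; Is-just)
open import Data.Product using (_×_; Σ; ∃; _,_)
open import Relation.Binary.PropositionalEquality using (_≡_; _≢_)
open import Relation.Nullary using (¬_)
open import Function.Bundles using (_⇔_)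

-- Variables are natural numbers; ⊥ = false, ⊤ = true.
Var : Set
Var = ℕ

-- An xor-constraint  x₁ ⊕ … ⊕ x_k ≡ p  (duplicates allowed, they cancel).
record XorConstraint : Set where
  constructor _≡ₓ_
  field
    vars   : List Var
    parity : Bool
open XorConstraint public

Formula : Set
Formula = List XorConstraint

varsOf : Formula → List Var
varsOf = concatMap XorConstraint.vars

TotalAssignment : Set
TotalAssignment = Var → Bool

xorSum : TotalAssignment → List Var → Bool
xorSum σ = foldr (λ x b → σ x xor b) false

SatC : TotalAssignment → XorConstraint → Set
SatC σ c = xorSum σ (XorConstraint.vars c) ≡ XorConstraint.parity c

Sat : TotalAssignment → Formula → Set
Sat σ φ = All (SatC σ) φ

Satisfiable : Formula → Set
Satisfiable φ = ∃ λ σ → Sat σ φ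

PartialAssignment : Set
PartialAssignment = Var → Maybe Bool

OnVarsOf : PartialAssignment → Formula → Set
OnVarsOf τ φ = ∀ x b → τ x ≡ just b → x ∈ varsOf φ

Extends : TotalAssignment → PartialAssignment → Set
Extends σ τ = ∀ x b → τ x ≡ just b → σ x ≡ b

record Equation : Set where
  constructor _:=_⊕_
  field
    lhs    : Var
    rhs    : List Var
    par    : Bool
open Equation public

eqConstraint : Equation → XorConstraint
eqConstraint e = (lhs e ∷ rhs e) ≡ₓ par e

Tableau : Set
Tableau = List Equation

record IsTableau (φ : Formula) (E : Tableau) : Set where
  field
    lhs∉rhs     : ∀ e → e ∈ E → lhs e ∉ rhs e
    rhsUnique   : ∀ e → e ∈ E → Unique (rhs e)
    lhsInφ      : ∀ e → e ∈ E → lhs e ∈ varsOf φ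
    rhsInφ      : ∀ e → e ∈ E → All (_∈ varsOf φ) (rhs e)
    lhsUnique   : ∀ e e′ → e ∈ E → e′ ∈ E → lhs e ≡ lhs e′ → e ≡ e′
    lhsNotInRhs : ∀ e e′ → e ∈ E → e′ ∈ E → lhs e ∉ rhs e′
    equiv       : ∀ σ → Sat σ φ ⇔ Sat σ (Data.List.map eqConstraint E)

xorSumP : PartialAssignment → List Var → Maybe Bool
xorSumP τ [] = just false
xorSumP τ (x ∷ xs) with τ x | xorSumP τ xs
... | just a | just b = just (a xor b)
... | _      | _      = nothing

PropagationSaturated : Tableau → PartialAssignment → Set
PropagationSaturated E τ =
  ∀ e → e ∈ E → Is-just (τ (lhs e)) ⇔ All (λ x → Is-just (τ x)) (rhs e)

Consistent : Tableau → PartialAssignment → Set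
Consistent E τ =
  ∀ e → e ∈ E → ∀ b c → τ (lhs e) ≡ just b → xorSumP τ (rhs e) ≡ just c →
  b ≡ c xor par e

restrictRhs : PartialAssignment → List Var → List Var
restrictRhs τ [] = []
restrictRhs τ (x ∷ xs) with τ x
... | just _  = restrictRhs τ xs
... | nothing = x ∷ restrictRhs τ xs

restrictPar : PartialAssignment → List Var → Bool → Bool
restrictPar τ [] p = p
restrictPar τ (x ∷ xs) p with τ x
... | just v  = v xor restrictPar τ xs p
... | nothing = restrictPar τ xs p

restrict : Equation → PartialAssignment → Equation
restrict e τ = lhs e := restrictRhs τ (rhs e) ⊕ restrictPar τ (rhs e) (par e)

-- x occurs an odd number of times in xs (i.e. survives pairwise cancellation).
occursOdd : Var → List Var → Bool
occursOdd x = foldr (λ v b → (v ≡ᵇ x) xor b) false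

SumIsConst : Equation → Equation → Bool → Set
SumIsConst f g p = (∀ x → occursOdd x (rhs f ++ rhs g) ≡ false) × (par f xor par g ≡ p)

Entails : Formula → PartialAssignment → Var → Var → Bool → Set
Entails φ τ y z p = ∀ σ → Sat σ φ → Extends σ τ → σ y xor σ z ≡ p

-- Fix any assignment s. Giving every non-basic variable its value under τ, or under s if τ leaves it
-- unassigned, and computing every basic variable from its equation yields a model of φ; consistency and
-- propagation saturation make it extend τ. In this model every variable is an affine xor-form in s: a constant
-- if assigned, the variable itself if unassigned and non-basic, and the right-hand side of e|τ if it is the
-- left-hand side of e. If y ⊕ z ≡ p holds in all these models, the xor of the two forms is the constant p, so
-- their constants xor to p and their variables cancel in pairs. Since the form of an unassigned variable is
-- non-constant and duplicate-free, this leaves exactly the four listed cases. Conversely every model extending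
-- τ satisfies e|τ for each equation e, which makes each case sound.

module Submission where

open import Defs
open import Data.Bool using (Bool; true; false; _xor_; _∧_; not)
open import Data.Bool.Properties
  using (xor-assoc; xor-comm; xor-same; xor-identityʳ; not-involutive; xor-∧-commutativeRing)
open import Data.Nat using (_≡ᵇ_)
open import Data.Nat.Properties using (_≟_)
open import Data.List using (List; []; _∷_; _++_; filter)
open import Data.List.Properties using (++-identityʳ)
open import Data.List.Membership.Propositional using (_∈_; _∉_; find; lose)
open import Data.List.Membership.Propositional.Properties using (∈-filter⁻)
open import Data.List.Relation.Binary.Subset.Propositional using (_⊆_)
open import Data.List.Relation.Unary.Any using (here; there; any?)
open import Data.List.Relation.Unary.All as All using (All; []; _∷_)
open import Data.List.Relation.Unary.All.Properties using (map⁺; map⁻; All¬⇒¬Any)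
open import Data.List.Relation.Unary.AllPairs using ([]; _∷_)
open import Data.List.Relation.Unary.Unique.Propositional using (Unique)
open import Data.Maybe using (Maybe; just; nothing; Is-just; fromMaybe)
import Data.Maybe.Relation.Unary.Any as Maybe
open import Data.Product using (_×_; ∃; ∃₂; _,_; proj₁; proj₂)
open import Data.Sum using (_⊎_; inj₁; inj₂)
open import Data.Empty using (⊥-elim)
open import Function using (_∘_)
open import Function.Bundles using (_⇔_; mk⇔; Equivalence)
open import Algebra.Bundles using (CommutativeRing)
open import Algebra.Properties.CommutativeSemigroup
  (CommutativeRing.+-commutativeSemigroup xor-∧-commutativeRing) using (interchange; x∙yz≈y∙xz)
open import Relation.Nullary using (¬_; ¬?; yes; no)
open import Relation.Nullary.Decidable using (dec-true; dec-false)
open import Relation.Binary.PropositionalEquality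
  using (_≡_; _≢_; refl; sym; trans; cong; cong₂; subst; module ≡-Reasoning)

xor-xor-cancelʳ : ∀ a b → (a xor b) xor b ≡ a
xor-xor-cancelʳ a b = trans (xor-assoc a b b) (trans (cong (a xor_) (xor-same b)) (xor-identityʳ a))

≡xor⇒xor≡ : ∀ {a b p} → a ≡ b xor p → a xor b ≡ p
≡xor⇒xor≡ {b = b} {p} refl = trans (cong (_xor b) (xor-comm b p)) (xor-xor-cancelʳ p b)

xor≡⇒≡xor : ∀ {a b p} → a xor b ≡ p → a ≡ b xor p
xor≡⇒≡xor {a} {b} refl = sym (trans (xor-comm b (a xor b)) (xor-xor-cancelʳ a b))

≡ᵇ-refl : ∀ x → (x ≡ᵇ x) ≡ true
≡ᵇ-refl x = dec-true (x ≟ x) refl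

≢⇒≡ᵇ-false : ∀ {x y} → x ≢ y → (x ≡ᵇ y) ≡ false
≢⇒≡ᵇ-false {x} {y} = dec-false (x ≟ y)

-- Xor-sums as linear forms

-- occursOdd w is definitionally xorSum at the indicator assignment (_≡ᵇ w); proofs below use this silently.
Cancels : List Var → Set
Cancels xs = ∀ w → occursOdd w xs ≡ false

xorSum-++ : ∀ σ xs ys → xorSum σ (xs ++ ys) ≡ xorSum σ xs xor xorSum σ ys
xorSum-++ σ []       ys = refl
xorSum-++ σ (x ∷ xs) ys = trans (cong (σ x xor_) (xorSum-++ σ xs ys)) (sym (xor-assoc (σ x) _ _))

xorSum-cong : ∀ {f g} xs → (∀ {v} → v ∈ xs → f v ≡ g v) → xorSum f xs ≡ xorSum g xs
xorSum-cong []       f≗g = refl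
xorSum-cong (x ∷ xs) f≗g = cong₂ _xor_ (f≗g (here refl)) (xorSum-cong xs (f≗g ∘ there))

xorSum-false : ∀ xs → xorSum (λ _ → false) xs ≡ false
xorSum-false []       = refl
xorSum-false (x ∷ xs) = xorSum-false xs

dropAll : Var → List Var → List Var
dropAll k = filter (λ v → ¬? (v ≟ k))

xorSum-dropAll : ∀ σ k xs → xorSum σ xs ≡ (occursOdd k xs ∧ σ k) xor xorSum σ (dropAll k xs)
xorSum-dropAll σ k [] = refl
xorSum-dropAll σ k (x ∷ xs) with x ≟ k | xorSum-dropAll σ k xs
... | yes refl | ih rewrite ≡ᵇ-refl x =
  trans (cong (σ x xor_) ih) (flip-occurrence (occursOdd x xs) (σ x) _)
  where
  flip-occurrence : ∀ o s r → s xor ((o ∧ s) xor r) ≡ (not o ∧ s) xor r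
  flip-occurrence false s r = refl
  flip-occurrence true false r = refl
  flip-occurrence true true r = not-involutive r
... | no x≢k | ih rewrite ≢⇒≡ᵇ-false x≢k =
  trans (cong (σ x xor_) ih) (x∙yz≈y∙xz (σ x) (occursOdd k xs ∧ σ k) (xorSum σ (dropAll k xs)))

dropAll-⊆ : ∀ k K xs → xs ⊆ k ∷ K → dropAll k xs ⊆ K
dropAll-⊆ k K xs xs⊆ v∈ with ∈-filter⁻ (λ v → ¬? (v ≟ k)) {xs = xs} v∈
... | v∈xs , v≢k with xs⊆ v∈xs
...   | here v≡k  = ⊥-elim (v≢k v≡k)
...   | there v∈K = v∈K

dropAll-cancels : ∀ k xs → Cancels xs → Cancels (dropAll k xs)
dropAll-cancels k xs c w = begin
  occursOdd w ys                                  ≡⟨ cong (λ o → (o ∧ (k ≡ᵇ w)) xor occursOdd w ys) (c k) ⟨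
  (occursOdd k xs ∧ (k ≡ᵇ w)) xor occursOdd w ys  ≡⟨ xorSum-dropAll (_≡ᵇ w) k xs ⟨
  occursOdd w xs                                  ≡⟨ c w ⟩
  false                                           ∎
  where
  open ≡-Reasoning
  ys : List Var
  ys = dropAll k xs

-- Induction on a list K covering xs: each step removes all copies of one variable, which are evenly many.
xorSum-cancels-⊆ : ∀ σ K xs → xs ⊆ K → Cancels xs → xorSum σ xs ≡ false
xorSum-cancels-⊆ σ []      []      _   _ = refl
xorSum-cancels-⊆ σ []      (x ∷ _) xs⊆ _ with xs⊆ (here refl)
... | ()
xorSum-cancels-⊆ σ (k ∷ K) xs xs⊆ c = begin
  xorSum σ xs                             ≡⟨ xorSum-dropAll σ k xs ⟩
  (occursOdd k xs ∧ σ k) xor xorSum σ ys  ≡⟨ cong (λ o → (o ∧ σ k) xor xorSum σ ys) (c k) ⟩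
  xorSum σ ys                             ≡⟨ xorSum-cancels-⊆ σ K ys ys⊆K (dropAll-cancels k xs c) ⟩
  false                                   ∎
  where
  open ≡-Reasoning
  ys : List Var
  ys = dropAll k xs
  ys⊆K : ys ⊆ K
  ys⊆K = dropAll-⊆ k K xs xs⊆

xorSum-cancels : ∀ σ xs → Cancels xs → xorSum σ xs ≡ false
xorSum-cancels σ xs = xorSum-cancels-⊆ σ xs xs (λ v∈ → v∈)

_≈⊕_ : List Var → List Var → Set
xs ≈⊕ ys = ∀ w → occursOdd w xs ≡ occursOdd w ys

cancels-++ : ∀ xs ys → Cancels (xs ++ ys) → xs ≈⊕ ys
cancels-++ xs ys c w =
  trans (xor≡⇒≡xor (trans (sym (xorSum-++ (_≡ᵇ w) xs ys)) (c w))) (xor-identityʳ _)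

-- Evaluating at the all-false assignment and at the indicator of w reads off each coefficient.
constant-form : ∀ xs c q → (∀ σ → xorSum σ xs xor c ≡ q) → c ≡ q × Cancels xs
constant-form xs c q h = c≡q , λ w → trans (xor≡⇒≡xor (trans (h (_≡ᵇ w)) (sym c≡q))) (xor-same c)
  where
  c≡q : c ≡ q
  c≡q = trans (cong (_xor c) (sym (xorSum-false xs))) (h (λ _ → false))

≡nothing⇒¬Is-just : ∀ {m : Maybe Bool} → m ≡ nothing → ¬ Is-just m
≡nothing⇒¬Is-just refl ()

≡true⇒≢false : ∀ {b} → b ≡ true → b ≢ false
≡true⇒≢false refl ()

odd⇒¬cancels : ∀ w xs → occursOdd w xs ≡ true → ¬ Cancels xs
odd⇒¬cancels w xs odd c = ≡true⇒≢false odd (c w)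

occursOdd-∉ : ∀ {w} xs → w ∉ xs → occursOdd w xs ≡ false
occursOdd-∉ []       w∉ = refl
occursOdd-∉ (x ∷ xs) w∉ =
  cong₂ _xor_ (≢⇒≡ᵇ-false (w∉ ∘ here ∘ sym)) (occursOdd-∉ xs (w∉ ∘ there))

occursOdd-unique : ∀ {w} xs → Unique xs → w ∈ xs → occursOdd w xs ≡ true
occursOdd-unique {w} (x ∷ xs) (x∉xs ∷ _) (here refl) =
  cong₂ _xor_ (≡ᵇ-refl w) (occursOdd-∉ xs (All¬⇒¬Any x∉xs))
occursOdd-unique (x ∷ xs) (x≢xs ∷ u) (there w∈) =
  cong₂ _xor_ (≢⇒≡ᵇ-false (All.lookup x≢xs w∈)) (occursOdd-unique xs u w∈)

∈-≈⊕-singleton : ∀ {z v} xs → Unique xs → xs ≈⊕ (z ∷ []) → v ∈ xs → v ≡ z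
∈-≈⊕-singleton {z} {v} xs u xs≈z v∈ with v ≟ z
... | yes v≡z = v≡z
... | no v≢z = ⊥-elim (≡true⇒≢false (occursOdd-unique xs u v∈) (trans (xs≈z v) z≢ᵇv))
  where
  z≢ᵇv : (z ≡ᵇ v) xor false ≡ false
  z≢ᵇv = cong (_xor false) (≢⇒≡ᵇ-false (v≢z ∘ sym))

unique-≈⊕-singleton : ∀ z xs → Unique xs → xs ≈⊕ (z ∷ []) → xs ≡ z ∷ []
unique-≈⊕-singleton z [] _ []≈z = ⊥-elim (≡true⇒≢false (cong (_xor false) (≡ᵇ-refl z)) (sym ([]≈z z)))
unique-≈⊕-singleton z (x ∷ []) u xs≈z = cong (_∷ []) (∈-≈⊕-singleton (x ∷ []) u xs≈z (here refl))
unique-≈⊕-singleton z xs@(x ∷ x′ ∷ _) u@(x≢ ∷ _) xs≈z =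
  ⊥-elim (All.lookup x≢ (here refl) (trans (∈-≈⊕-singleton {z} xs u xs≈z (here refl))
                                            (sym (∈-≈⊕-singleton {z} xs u xs≈z (there (here refl))))))

rhsValue : TotalAssignment → Equation → Bool
rhsValue σ e = xorSum σ (rhs e) xor par e

sumIsConst-value : ∀ σ f g {p} → SumIsConst f g p → rhsValue σ f xor rhsValue σ g ≡ p
sumIsConst-value σ f g {p} (c , f⊕g≡p) = begin
  rhsValue σ f xor rhsValue σ g                  ≡⟨ interchange (xorSum σ (rhs f)) (par f) _ (par g) ⟩
  (xorSum σ (rhs f) xor xorSum σ (rhs g)) xor q  ≡⟨ cong (_xor q) (xorSum-++ σ (rhs f) (rhs g)) ⟨
  xorSum σ (rhs f ++ rhs g) xor q                ≡⟨ cong (_xor q) (xorSum-cancels σ (rhs f ++ rhs g) c) ⟩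
  q                                              ≡⟨ f⊕g≡p ⟩
  p                                              ∎
  where
  open ≡-Reasoning
  q : Bool
  q = par f xor par g

-- Restriction by a partial assignment

module Restriction (τ : PartialAssignment) where

  fill : TotalAssignment → TotalAssignment
  fill s v = fromMaybe (s v) (τ v)

  fill-extension : ∀ {σ} → Extends σ τ → ∀ v → fill σ v ≡ σ v
  fill-extension {σ} ext v with τ v in eq
  ... | just b  = sym (ext v b eq)
  ... | nothing = refl

  xorSum-fill : ∀ s xs q → xorSum (fill s) xs xor q ≡ xorSum s (restrictRhs τ xs) xor restrictPar τ xs q
  xorSum-fill s []       q = refl
  xorSum-fill s (x ∷ xs) q with τ x | xorSum-fill s xs q
  ... | just a  | ih =
    trans (xor-assoc a _ q) (trans (cong (a xor_) ih) (x∙yz≈y∙xz a (xorSum s (restrictRhs τ xs)) _))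
  ... | nothing | ih =
    trans (xor-assoc (s x) _ q) (trans (cong (s x xor_) ih) (sym (xor-assoc (s x) (xorSum s (restrictRhs τ xs)) _)))

  rhsValue-fill : ∀ s e → rhsValue (fill s) e ≡ rhsValue s (restrict e τ)
  rhsValue-fill s e = xorSum-fill s (rhs e) (par e)

  restrictRhs-⊆ : ∀ xs → restrictRhs τ xs ⊆ xs
  restrictRhs-⊆ (x ∷ xs) v∈ with τ x | v∈
  ... | just _  | v∈′        = there (restrictRhs-⊆ xs v∈′)
  ... | nothing | here v≡x   = here v≡x
  ... | nothing | there v∈′  = there (restrictRhs-⊆ xs v∈′)

  restrictRhs-unique : ∀ xs → Unique xs → Unique (restrictRhs τ xs)
  restrictRhs-unique []       _           = []
  restrictRhs-unique (x ∷ xs) (x∉xs ∷ u) with τ x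
  ... | just _  = restrictRhs-unique xs u
  ... | nothing = All.tabulate (All.lookup x∉xs ∘ restrictRhs-⊆ xs) ∷ restrictRhs-unique xs u

  restrictRhs-nonempty : ∀ xs → ¬ All (λ x → Is-just (τ x)) xs → ∃ λ w → w ∈ restrictRhs τ xs
  restrictRhs-nonempty []       ¬all = ⊥-elim (¬all [])
  restrictRhs-nonempty (x ∷ xs) ¬all with τ x in eq
  ... | just _  = restrictRhs-nonempty xs (¬all ∘ (subst Is-just (sym eq) (Maybe.just _) ∷_))
  ... | nothing = x , here refl

  xorSumP-assigned : ∀ s xs → All (λ x → Is-just (τ x)) xs → xorSumP τ xs ≡ just (xorSum (fill s) xs)
  xorSumP-assigned s []       []           = refl
  xorSumP-assigned s (x ∷ xs) (x↓ ∷ xs↓) with τ x | x↓ | xorSumP τ xs | xorSumP-assigned s xs xs↓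
  ... | just a | _ | _ | refl = refl

-- Soundness

ImpliedViaTableau : Tableau → PartialAssignment → Var → Var → Bool → Set
ImpliedViaTableau E τ y z p =
  (τ y ≡ nothing × τ z ≡ nothing ×
      ∃ λ e → e ∈ E × lhs e ≡ y × z ∈ rhs e × restrict e τ ≡ (y := (z ∷ []) ⊕ p))
  ⊎ (τ y ≡ nothing × τ z ≡ nothing ×
      ∃ λ e → e ∈ E × lhs e ≡ z × y ∈ rhs e × restrict e τ ≡ (z := (y ∷ []) ⊕ p))
  ⊎ (τ y ≡ nothing × τ z ≡ nothing ×
      ∃₂ λ ey ez → ey ∈ E × ez ∈ E × lhs ey ≡ y × lhs ez ≡ z ×
        SumIsConst (restrict ey τ) (restrict ez τ) p)

ImpliedBinaryXor : Tableau → PartialAssignment → Var → Var → Bool → Set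
ImpliedBinaryXor E τ y z p =
  (∃₂ λ a b → τ y ≡ just a × τ z ≡ just b × a xor b ≡ p) ⊎ ImpliedViaTableau E τ y z p

module _ {φ : Formula} {E : Tableau} (T : IsTableau φ E) where
  open IsTableau T

  equation-holds : ∀ {σ e} → Sat σ φ → e ∈ E → σ (lhs e) ≡ rhsValue σ e
  equation-holds {σ} sat e∈ =
    xor≡⇒≡xor (All.lookup (map⁻ {f = eqConstraint} (Equivalence.to (equiv σ) sat)) e∈)

  restriction-holds : ∀ {τ σ e} → Sat σ φ → Extends σ τ → e ∈ E →
                      σ (lhs e) ≡ rhsValue σ (restrict e τ)
  restriction-holds {τ} {σ} {e} sat ext e∈ = begin
    σ (lhs e)                ≡⟨ equation-holds {σ} sat e∈ ⟩
    rhsValue σ e             ≡⟨ cong (_xor par e) (xorSum-cong (rhs e) (λ {v} _ → fill-extension ext v)) ⟨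
    rhsValue (fill σ) e      ≡⟨ rhsValue-fill σ e ⟩
    rhsValue σ (restrict e τ) ∎
    where open ≡-Reasoning
          open Restriction τ

  binary-restriction-holds : ∀ {τ σ e x w p} → Sat σ φ → Extends σ τ → e ∈ E →
                             restrict e τ ≡ (x := (w ∷ []) ⊕ p) → σ (lhs e) xor σ w ≡ p
  binary-restriction-holds {σ = σ} {e} {w = w} {p} sat ext e∈ e|τ≡ = ≡xor⇒xor≡ (begin
    σ (lhs e)                       ≡⟨ restriction-holds sat ext e∈ ⟩
    rhsValue σ (restrict e _)       ≡⟨ cong (rhsValue σ) e|τ≡ ⟩
    (σ w xor false) xor p           ≡⟨ cong (_xor p) (xor-identityʳ (σ w)) ⟩
    σ w xor p                       ∎)
    where open ≡-Reasoning

  implied⇒entailed : ∀ {τ y z p} → ImpliedBinaryXor E τ y z p → Entails φ τ y z p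
  implied⇒entailed {y = y} {z} (inj₁ (a , b , y↦a , z↦b , a⊕b≡p)) σ _ ext =
    trans (cong₂ _xor_ (ext y a y↦a) (ext z b z↦b)) a⊕b≡p
  implied⇒entailed (inj₂ (inj₁ (_ , _ , e , e∈ , refl , _ , e|τ≡))) σ sat ext =
    binary-restriction-holds sat ext e∈ e|τ≡
  implied⇒entailed {y = y} {z} (inj₂ (inj₂ (inj₁ (_ , _ , e , e∈ , refl , _ , e|τ≡)))) σ sat ext =
    trans (xor-comm (σ y) (σ z)) (binary-restriction-holds sat ext e∈ e|τ≡)
  implied⇒entailed (inj₂ (inj₂ (inj₂ (_ , _ , ey , ez , ey∈ , ez∈ , refl , refl , const)))) σ sat ext =
    trans (cong₂ _xor_ (restriction-holds sat ext ey∈) (restriction-holds sat ext ez∈))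
          (sumIsConst-value σ (restrict ey _) (restrict ez _) const)

-- Completeness

module CanonicalModel {φ : Formula} {E : Tableau} {τ : PartialAssignment} (T : IsTableau φ E)
                      (consistent : Consistent E τ) (saturated : PropagationSaturated E τ) where
  open IsTableau T
  open Restriction τ

  data Role (v : Var) : Set where
    basic    : ∀ {e} → e ∈ E → lhs e ≡ v → Role v
    nonbasic : (∀ {e} → e ∈ E → lhs e ≢ v) → Role v

  role : ∀ v → Role v
  role v with any? (λ e → lhs e ≟ v) E
  ... | yes lhs≡v = let _ , e∈ , e≡v = find lhs≡v in basic e∈ e≡v
  ... | no  lhs≢v = nonbasic (λ e∈ e≡v → lhs≢v (lose e∈ e≡v))

  model : TotalAssignment → TotalAssignment
  model s v with role v
  ... | basic {e} _ _ = rhsValue (fill s) e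
  ... | nonbasic _    = fill s v

  model-basic : ∀ s {e} → e ∈ E → model s (lhs e) ≡ rhsValue (fill s) e
  model-basic s {e} e∈ with role (lhs e)
  ... | basic e′∈ e′≡e = cong (rhsValue (fill s)) (lhsUnique _ _ e′∈ e∈ e′≡e)
  ... | nonbasic ≢e    = ⊥-elim (≢e e∈ refl)

  model-nonbasic : ∀ s {v} → (∀ {e} → e ∈ E → lhs e ≢ v) → model s v ≡ fill s v
  model-nonbasic s {v} ≢v with role v
  ... | basic e∈ e≡v = ⊥-elim (≢v e∈ e≡v)
  ... | nonbasic _   = refl

  rhs-nonbasic : ∀ {e v} → e ∈ E → v ∈ rhs e → ∀ {e′} → e′ ∈ E → lhs e′ ≢ v
  rhs-nonbasic {e} e∈ v∈ e′∈ refl = lhsNotInRhs _ e e′∈ e∈ v∈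

  model-satisfies : ∀ s {e} → e ∈ E → SatC (model s) (eqConstraint e)
  model-satisfies s {e} e∈ = ≡xor⇒xor≡ (begin
    model s (lhs e)       ≡⟨ model-basic s e∈ ⟩
    rhsValue (fill s) e   ≡⟨ cong (_xor par e) (xorSum-cong (rhs e) (model-nonbasic s ∘ rhs-nonbasic e∈)) ⟨
    rhsValue (model s) e  ∎)
    where open ≡-Reasoning

  model-sat : ∀ s → Sat (model s) φ
  model-sat s = Equivalence.from (equiv (model s)) (map⁺ (All.tabulate (model-satisfies s)))

  model-extends : ∀ s → Extends (model s) τ
  model-extends s v b v↦b with role v
  ... | nonbasic _         = cong (fromMaybe (s v)) v↦b
  ... | basic {e} e∈ refl  = sym (consistent e e∈ b _ v↦b (xorSumP-assigned s (rhs e) rhs-assigned))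
    where
    rhs-assigned : All (λ x → Is-just (τ x)) (rhs e)
    rhs-assigned = Equivalence.to (saturated e e∈) (subst Is-just (sym v↦b) (Maybe.just _))

  restricted-unique : ∀ {e} → e ∈ E → Unique (restrictRhs τ (rhs e))
  restricted-unique {e} e∈ = restrictRhs-unique (rhs e) (rhsUnique e e∈)

  record Represents (v : Var) (xs : List Var) (c : Bool) : Set where
    constructor represents
    field value : ∀ s → model s v ≡ xorSum s xs xor c

  data Status (v : Var) : Set where
    assigned   : ∀ {a} → τ v ≡ just a → Status v
    unassigned : τ v ≡ nothing → Role v → Status v

  status : ∀ v → Status v
  status v with τ v in v↦
  ... | just _  = assigned v↦
  ... | nothing = unassigned v↦ (role v)

  formVars : ∀ {v} → Role v → List Var
  formVars {v} (nonbasic _)  = v ∷ []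
  formVars (basic {e} _ _)   = restrictRhs τ (rhs e)

  formConst : ∀ {v} → Role v → Bool
  formConst (nonbasic _)     = false
  formConst (basic {e} _ _)  = restrictPar τ (rhs e) (par e)

  assigned-represents : ∀ {v a} → τ v ≡ just a → Represents v [] a
  assigned-represents {v} {a} v↦a = represents λ s → model-extends s v a v↦a

  unassigned-represents : ∀ {v} → τ v ≡ nothing → (r : Role v) →
                          Represents v (formVars r) (formConst r)
  unassigned-represents v↦ (basic {e} e∈ refl) =
    represents λ s → trans (model-basic s e∈) (rhsValue-fill s e)
  unassigned-represents {v} v↦ (nonbasic ≢v) = represents λ s → begin
    model s v                  ≡⟨ model-nonbasic s ≢v ⟩
    fromMaybe (s v) (τ v)      ≡⟨ cong (fromMaybe (s v)) v↦ ⟩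
    s v                        ≡⟨ xor-identityʳ (s v) ⟨
    s v xor false              ≡⟨ xor-identityʳ (s v xor false) ⟨
    (s v xor false) xor false  ∎
    where open ≡-Reasoning

  unassigned-nonconstant : ∀ {v} → τ v ≡ nothing → (r : Role v) → ¬ Cancels (formVars r)
  unassigned-nonconstant {v} _ (nonbasic _) = odd⇒¬cancels v (v ∷ []) (cong (_xor false) (≡ᵇ-refl v))
  unassigned-nonconstant v↦ (basic {e} e∈ refl)
    with restrictRhs-nonempty (rhs e) (≡nothing⇒¬Is-just v↦ ∘ Equivalence.from (saturated e e∈))
  ... | w , w∈ = odd⇒¬cancels w (restrictRhs τ (rhs e)) (occursOdd-unique _ (restricted-unique e∈) w∈)

  entailed-form : ∀ {y z p xs c ys d} → Represents y xs c → Represents z ys d →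
                  Entails φ τ y z p → c xor d ≡ p × Cancels (xs ++ ys)
  entailed-form {y} {z} {p} {xs} {c} {ys} {d} (represents y≐) (represents z≐) ent =
    constant-form (xs ++ ys) (c xor d) p λ s → begin
      xorSum s (xs ++ ys) xor (c xor d)            ≡⟨ cong (_xor (c xor d)) (xorSum-++ s xs ys) ⟩
      (xorSum s xs xor xorSum s ys) xor (c xor d)  ≡⟨ interchange (xorSum s xs) (xorSum s ys) c d ⟩
      (xorSum s xs xor c) xor (xorSum s ys xor d)  ≡⟨ cong₂ _xor_ (y≐ s) (z≐ s) ⟨
      model s y xor model s z                      ≡⟨ ent (model s) (model-sat s) (model-extends s) ⟩
      p                                            ∎
    where open ≡-Reasoning

  restricted-to-binary : ∀ {e w p} → e ∈ E → restrictRhs τ (rhs e) ≈⊕ (w ∷ []) →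
                         restrictPar τ (rhs e) (par e) ≡ p →
                         w ∈ rhs e × restrict e τ ≡ (lhs e := (w ∷ []) ⊕ p)
  restricted-to-binary {e} {w} e∈ R≈w c≡p =
    restrictRhs-⊆ (rhs e) (subst (w ∈_) (sym R≡w) (here refl)) , cong₂ (lhs e :=_⊕_) R≡w c≡p
    where
    R≡w : restrictRhs τ (rhs e) ≡ w ∷ []
    R≡w = unique-≈⊕-singleton w (restrictRhs τ (rhs e)) (restricted-unique e∈) R≈w

  both-unassigned : ∀ {y z p} → y ≢ z → τ y ≡ nothing → τ z ≡ nothing → (ry : Role y) (rz : Role z) →
                    formConst ry xor formConst rz ≡ p × Cancels (formVars ry ++ formVars rz) →
                    ImpliedViaTableau E τ y z p
  both-unassigned {y} {z} y≢z _ _ (nonbasic _) (nonbasic _) (_ , c) =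
    ⊥-elim (odd⇒¬cancels y (y ∷ z ∷ []) (cong₂ _xor_ (≡ᵇ-refl y) (cong (_xor false) z≢ᵇy)) c)
    where
    z≢ᵇy : (z ≡ᵇ y) ≡ false
    z≢ᵇy = ≢⇒≡ᵇ-false (y≢z ∘ sym)
  both-unassigned {z = z} _ y↦ z↦ (basic {e} e∈ refl) (nonbasic _) (c⊕d≡p , c) =
    inj₁ (y↦ , z↦ , e , e∈ , refl , restricted-to-binary e∈ R≈z (trans (sym (xor-identityʳ _)) c⊕d≡p))
    where
    R≈z : restrictRhs τ (rhs e) ≈⊕ (z ∷ [])
    R≈z = cancels-++ (restrictRhs τ (rhs e)) (z ∷ []) c
  both-unassigned {y} _ y↦ z↦ (nonbasic _) (basic {e} e∈ refl) (c⊕d≡p , c) =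
    inj₂ (inj₁ (y↦ , z↦ , e , e∈ , refl , restricted-to-binary e∈ R≈y c⊕d≡p))
    where
    R≈y : restrictRhs τ (rhs e) ≈⊕ (y ∷ [])
    R≈y w = sym (cancels-++ (y ∷ []) (restrictRhs τ (rhs e)) c w)
  both-unassigned _ y↦ z↦ (basic {ey} ey∈ refl) (basic {ez} ez∈ refl) (c⊕d≡p , c) =
    inj₂ (inj₂ (y↦ , z↦ , ey , ez , ey∈ , ez∈ , refl , refl , c , c⊕d≡p))

  entailed⇒implied : ∀ {y z p} → y ≢ z → Entails φ τ y z p → ImpliedBinaryXor E τ y z p
  entailed⇒implied {y} {z} y≢z ent with status y | status z
  ... | assigned y↦ | assigned z↦ =
    inj₁ (_ , _ , y↦ , z↦ , proj₁ (entailed-form (assigned-represents y↦) (assigned-represents z↦) ent))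
  ... | assigned y↦ | unassigned z↦ rz =
    ⊥-elim (unassigned-nonconstant z↦ rz
      (proj₂ (entailed-form (assigned-represents y↦) (unassigned-represents z↦ rz) ent)))
  ... | unassigned y↦ ry | assigned z↦ =
    ⊥-elim (unassigned-nonconstant y↦ ry (subst Cancels (++-identityʳ (formVars ry))
      (proj₂ (entailed-form (unassigned-represents y↦ ry) (assigned-represents z↦) ent))))
  ... | unassigned y↦ ry | unassigned z↦ rz =
    inj₂ (both-unassigned y≢z y↦ z↦ ry rz
      (entailed-form (unassigned-represents y↦ ry) (unassigned-represents z↦ rz) ent))

lemma3 : (φ : Formula) → Satisfiable φ →
    (E : Tableau) (τ : PartialAssignment) →
    IsTableau φ E → OnVarsOf τ φ →
    Consistent E τ → PropagationSaturated E τ →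
    (y z : Var) → y ∈ varsOf φ → z ∈ varsOf φ → y ≢ z → (p : Bool) →
    Entails φ τ y z p ⇔
      ((∃₂ λ a b → τ y ≡ just a × τ z ≡ just b × a xor b ≡ p)
      ⊎ (τ y ≡ nothing × τ z ≡ nothing ×
          ∃ λ e → e ∈ E × lhs e ≡ y × z ∈ rhs e × restrict e τ ≡ (y := (z ∷ []) ⊕ p))
      ⊎ (τ y ≡ nothing × τ z ≡ nothing ×
          ∃ λ e → e ∈ E × lhs e ≡ z × y ∈ rhs e × restrict e τ ≡ (z := (y ∷ []) ⊕ p))
      ⊎ (τ y ≡ nothing × τ z ≡ nothing ×
          ∃₂ λ ey ez → ey ∈ E × ez ∈ E × lhs ey ≡ y × lhs ez ≡ z ×
            SumIsConst (restrict ey τ) (restrict ez τ) p))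
lemma3 φ _ E τ T _ consistent saturated y z _ _ y≢z p =
  mk⇔ (CanonicalModel.entailed⇒implied T consistent saturated y≢z) (implied⇒entailed T)
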